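{- Let $e$ and $d$ be degree sequences such that $e\preccurlyeq d$ in the Rao order. Then $\Delta_{m(e)}(e)\le\Delta_{m(d)}(d)$.
   Context: Degree sequences are written in nonincreasing order. For degree sequences $e,d$, $e\preccurlyeq d$ (Rao order) means there exist a simple graph $H$ with degree sequence $e$ and a simple graph $G$ with degree sequence $d$ such that $H$ is an induced subgraph of $G$. $m(d)=\max\{i:d_i\ge i-1\}$ and $\Delta_k(d)=k(k-1)+\sum_{i>k}\min\{k,d_i\}-\sum_{i\le k}d_i$. -}

module Defs where

open import Data.Nat using (ℕ; zero; suc; _*_; _∸_; _⊓_; _⊔_; _≤ᵇ_; _≥_)
open import Data.Integer as ℤ using (ℤ; +_)
open import Data.Bool using (Bool; true; false; if_then_else_)
open import Data.Fin using (Fin)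
open import Data.List using (List; []; _∷_; map; take; drop; allFin)
open import Data.Nat.ListAction using (sum)
open import Data.List.Relation.Unary.Linked using (Linked)
open import Data.List.Relation.Binary.Permutation.Propositional using (_↭_)
open import Data.Product using (Σ; _×_; ∃)
open import Function.Definitions using (Injective)
open import Relation.Binary.PropositionalEquality using (_≡_)

record Graph (n : ℕ) : Set where
  field
    adj    : Fin n → Fin n → Bool
    sym    : ∀ u v → adj u v ≡ adj v u
    irrefl : ∀ v → adj v v ≡ false
open Graph public

deg : ∀ {n} → Graph n → Fin n → ℕ
deg {n} G v = sum (map (λ u → if adj G v u then 1 else 0) (allFin n))

degrees : ∀ {n} → Graph n → List ℕ
degrees {n} G = map (deg G) (allFin n)

Nonincreasing : List ℕ → Set
Nonincreasing = Linked _≥_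

IsDegSeqOf : ∀ {n} → List ℕ → Graph n → Set
IsDegSeqOf d G = Nonincreasing d × (d ↭ degrees G)

IsDegreeSequence : List ℕ → Set
IsDegreeSequence d = Σ ℕ λ n → Σ (Graph n) λ G → IsDegSeqOf d G

InducedSubgraph : ∀ {p n} → Graph p → Graph n → Set
InducedSubgraph {p} {n} H G =
  Σ (Fin p → Fin n) λ f → Injective _≡_ _≡_ f × (∀ u v → adj H u v ≡ adj G (f u) (f v))

_≼_ : List ℕ → List ℕ → Set
e ≼ d = Σ ℕ λ p → Σ ℕ λ n → Σ (Graph p) λ H → Σ (Graph n) λ G →
          IsDegSeqOf e H × IsDegSeqOf d G × InducedSubgraph H G

-- m(d) = max { i (1-indexed) : d_i ≥ i - 1 }, with the convention 0 for the empty sequence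
mFrom : ℕ → List ℕ → ℕ
mFrom i []       = 0
mFrom i (x ∷ xs) = (if (i ∸ 1) ≤ᵇ x then i else 0) ⊔ mFrom (suc i) xs

m : List ℕ → ℕ
m d = mFrom 1 d

Δ : ℕ → List ℕ → ℤ
Δ k d = (+ (k * (k ∸ 1)) ℤ.+ + sum (map (k ⊓_) (drop k d))) ℤ.- + sum (take k d)

-- For a vertex set S of a graph G with |S| = k, let σ(G, S) count the ordered pairs of
-- distinct vertices that are non-adjacent inside S or adjacent outside S (twice the number of edge
-- edits turning S into a clique and its complement into an independent set). Double counting gives
--   σ(G, S) = k(k-1) + Σ_{v∉S} deg v - Σ_{v∈S} deg v,
-- and σ can only decrease when passing to an induced subgraph. If S consists of the m(d) vertices of
-- largest degree, all other degrees are at most m(d), so σ(G, S) = Δ_{m(d)}(d). Conversely, since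
-- k ↦ Σ_{i≤k} d_i - k(k-1)/2 is maximal at k = m(d), every vertex set S of a realisation of d has
-- Δ_{m(d)}(d) ≤ σ(G, S). Taking for S the trace on H of the top m(d) vertices of G closes the chain.
module Submission where

open import Defs renaming (sym to adj-sym)
import Algebra.Properties.CommutativeMonoid.Sum
open import Data.Bool using (Bool; true; false; if_then_else_)
open import Data.Fin using (Fin; zero; suc; punchIn; punchOut)
open import Data.Fin.Properties using (_≟_; punchIn-punchOut; punchOut-injective)
import Data.Fin.Properties as Fin
import Data.Integer as ℤ
import Data.Integer.Properties as ℤ
open import Data.List using (List; []; _∷_; map; take; drop; length; tabulate)
open import Data.List.Properties using (map-tabulate; take++drop≡id; ∷-injective)
open import Data.List.Relation.Binary.Permutation.Propositional using (_↭_; ↭-sym)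
open import Data.List.Relation.Binary.Permutation.Propositional.Properties using (map⁺; ↭-map-inv)
open import Data.List.Relation.Unary.All as All using (All; []; _∷_)
open import Data.List.Relation.Unary.AllPairs using (_∷_)
import Data.List.Relation.Unary.Linked as Linked
open import Data.List.Relation.Unary.Linked.Properties using (Linked⇒AllPairs)
open import Data.Nat using (ℕ; zero; suc; _+_; _*_; _∸_; _≤_; _⊓_; _⊔_; _≤ᵇ_; z≤n; s≤s)
open import Data.Nat.ListAction using (sum)
open import Data.Nat.ListAction.Properties using (sum-↭; sum-++)
open import Data.Nat.Properties hiding (_≟_)
open import Data.Nat.Solver using (module +-*-Solver)
open import Data.Product using (∃; _×_; _,_; proj₁; proj₂)
open import Data.Vec.Functional as Vector using (removeAt)
open import Function using (_∘_; id)
open import Function.Definitions using (Injective)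
open import Relation.Nullary using (does; yes; no; ofʸ; ofⁿ; contradiction)
open import Relation.Nullary.Decidable using (dec-true; dec-false)
open import Relation.Binary.PropositionalEquality

open import Algebra.Properties.CommutativeSemigroup +-commutativeSemigroup using (x∙yz≈y∙xz; interchange)
open Algebra.Properties.CommutativeMonoid.Sum +-0-commutativeMonoid
  using (sum-syntax; sum-cong-≗; ∑-distrib-+; ∑-comm; sum-replicate-zero; sum-remove)
  renaming (sum to ∑)

∑-mono-≤ : ∀ {n} {f g : Fin n → ℕ} → (∀ i → f i ≤ g i) → ∑ f ≤ ∑ g
∑-mono-≤ {zero}  f≤g = z≤n
∑-mono-≤ {suc n} f≤g = +-mono-≤ (f≤g zero) (∑-mono-≤ (f≤g ∘ suc))

∑-∘-injective-≤ : ∀ {p n} (g : Fin n → ℕ) {f : Fin p → Fin n} → Injective _≡_ _≡_ f →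
                  ∑[ u < p ] g (f u) ≤ ∑ g
∑-∘-injective-≤ {zero}  g f-inj = z≤n
∑-∘-injective-≤ {suc p} {zero}  g {f} f-inj with () ← f zero
∑-∘-injective-≤ {suc p} {suc n} g {f} f-inj = begin
  g (f zero) + ∑[ u < p ] g (f (suc u))
    ≡⟨ cong (g (f zero) +_) (sum-cong-≗ (cong g ∘ sym ∘ punchIn-punchOut ∘ f₀≢)) ⟩
  g (f zero) + ∑[ u < p ] removeAt g (f zero) (f′ u)
    ≤⟨ +-monoʳ-≤ (g (f zero)) (∑-∘-injective-≤ (removeAt g (f zero)) f′-inj) ⟩
  g (f zero) + ∑ (removeAt g (f zero))
    ≡⟨ sum-remove g ⟨
  ∑ g ∎
  where
  open ≤-Reasoning
  f₀≢ : ∀ u → f zero ≢ f (suc u)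
  f₀≢ u eq with () ← f-inj eq
  f′ : Fin p → Fin n
  f′ u = punchOut (f₀≢ u)
  f′-inj : Injective _≡_ _≡_ f′
  f′-inj eq = Fin.suc-injective (f-inj (punchOut-injective (f₀≢ _) (f₀≢ _) eq))

∑-punctured : ∀ {n} (u : Fin n) (g : Fin n → ℕ) →
              ∑[ v < n ] (if does (u ≟ v) then 0 else g v) + g u ≡ ∑ g
∑-punctured zero    g = +-comm (∑ (g ∘ suc)) (g zero)
∑-punctured (suc u) g = trans (+-assoc (g zero) _ (g (suc u))) (cong (g zero +_) (∑-punctured u (g ∘ suc)))

∑-if-const : ∀ {n} (χ : Fin n → Bool) (c : ℕ) →
             ∑[ u < n ] (if χ u then c else 0) ≡ ∑[ u < n ] (if χ u then 1 else 0) * c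
∑-if-const {zero}  χ c = refl
∑-if-const {suc n} χ c with χ zero
... | true  = cong (c +_) (∑-if-const (χ ∘ suc) c)
... | false = ∑-if-const (χ ∘ suc) c

sum-tabulate : ∀ {n} (g : Fin n → ℕ) → sum (tabulate g) ≡ ∑ g
sum-tabulate {zero}  g = refl
sum-tabulate {suc n} g = cong (g zero +_) (sum-tabulate (g ∘ suc))

does-≟-injective : ∀ {p n} {f : Fin p → Fin n} → Injective _≡_ _≡_ f →
                   ∀ u v → does (f u ≟ f v) ≡ does (u ≟ v)
does-≟-injective {f = f} f-inj u v with u ≟ v
... | yes refl = dec-true (f u ≟ f u) refl
... | no u≢v   = dec-false (f u ≟ f v) (u≢v ∘ f-inj)

∑₂ : ∀ {n} → (Fin n → Fin n → ℕ) → ℕ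
∑₂ {n} f = ∑[ u < n ] ∑[ v < n ] f u v

∑₂-distrib-+ : ∀ {n} (f g : Fin n → Fin n → ℕ) → ∑₂ (λ u v → f u v + g u v) ≡ ∑₂ f + ∑₂ g
∑₂-distrib-+ f g = trans (sum-cong-≗ (λ u → ∑-distrib-+ (f u) (g u))) (∑-distrib-+ (∑ ∘ f) (∑ ∘ g))

size : ∀ {n} → (Fin n → Bool) → ℕ
size {n} χ = ∑[ u < n ] (if χ u then 1 else 0)

module _ {n : ℕ} (G : Graph n) where

  edge : Fin n → Fin n → ℕ
  edge u v = if adj G u v then 1 else 0

  deg≡∑edge : ∀ u → deg G u ≡ ∑ (edge u)
  deg≡∑edge u = trans (cong sum (map-tabulate id (edge u))) (sum-tabulate (edge u))

  module _ (χ : Fin n → Bool) where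

    degSumIn degSumOut : ℕ
    degSumIn  = ∑[ u < n ] (if χ u then deg G u else 0)
    degSumOut = ∑[ u < n ] (if χ u then 0 else deg G u)

    splitPair : Fin n → Fin n → ℕ
    splitPair u v with χ u | χ v
    ... | true  | true  = if does (u ≟ v) then 0 else (if adj G u v then 0 else 1)
    ... | true  | false = 0
    ... | false | true  = 0
    ... | false | false = edge u v

    -- σ(G, S) for S = {u | χ u}.
    splitCost : ℕ
    splitCost = ∑₂ splitPair

    private
      inDeg outDeg crossing distinctIn : Fin n → Fin n → ℕ
      inDeg u v      = if χ u then edge u v else 0
      outDeg u v     = if χ u then 0 else edge u v
      crossing u v   = if χ u then 0 else (if χ v then edge u v else 0)
      distinctIn u v = if χ u then (if χ v then (if does (u ≟ v) then 0 else 1) else 0) else 0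

      splitPair-balance : ∀ u v → splitPair u v + inDeg u v + crossing u v ≡
                                  distinctIn u v + outDeg u v + crossing v u
      splitPair-balance u v with χ u | χ v
      ... | true  | false = trans (+-identityʳ (edge u v)) (cong (λ b → if b then 1 else 0) (adj-sym G u v))
      ... | false | true  = sym (+-identityʳ (edge u v))
      ... | false | false = +-identityʳ (edge u v + 0)
      ... | true  | true  with u ≟ v
      ...   | yes refl rewrite irrefl G u = refl
      ...   | no _ with adj G u v
      ...     | true  = refl
      ...     | false = refl

      ∑inDeg : ∑₂ inDeg ≡ degSumIn
      ∑inDeg = sum-cong-≗ λ u → lemma u
        where
        lemma : ∀ u → ∑ (inDeg u) ≡ (if χ u then deg G u else 0)
        lemma u with χ u
        ... | true  = sym (deg≡∑edge u)
        ... | false = sum-replicate-zero n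

      ∑outDeg : ∑₂ outDeg ≡ degSumOut
      ∑outDeg = sum-cong-≗ λ u → lemma u
        where
        lemma : ∀ u → ∑ (outDeg u) ≡ (if χ u then 0 else deg G u)
        lemma u with χ u
        ... | true  = sum-replicate-zero n
        ... | false = sym (deg≡∑edge u)

      ∑distinctIn : ∑₂ distinctIn ≡ size χ * (size χ ∸ 1)
      ∑distinctIn = trans (sum-cong-≗ lemma) (∑-if-const χ (size χ ∸ 1))
        where
        indicator : Fin n → ℕ
        indicator v = if χ v then 1 else 0
        lemma : ∀ u → ∑ (distinctIn u) ≡ (if χ u then size χ ∸ 1 else 0)
        lemma u with χ u in χu
        ... | false = sum-replicate-zero n
        ... | true  = begin
          ∑[ v < n ] (if χ v then (if does (u ≟ v) then 0 else 1) else 0)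
            ≡⟨ sum-cong-≗ punctured ⟩
          ∑[ v < n ] (if does (u ≟ v) then 0 else indicator v)
            ≡⟨ m+n∸n≡m _ 1 ⟨
          ∑[ v < n ] (if does (u ≟ v) then 0 else indicator v) + 1 ∸ 1
            ≡⟨ cong (λ i → ∑[ v < n ] (if does (u ≟ v) then 0 else indicator v) + i ∸ 1) indicator-u ⟨
          ∑[ v < n ] (if does (u ≟ v) then 0 else indicator v) + indicator u ∸ 1
            ≡⟨ cong (_∸ 1) (∑-punctured u indicator) ⟩
          size χ ∸ 1 ∎
          where
          open ≡-Reasoning
          indicator-u : indicator u ≡ 1
          indicator-u rewrite χu = refl
          punctured : ∀ v → (if χ v then (if does (u ≟ v) then 0 else 1) else 0) ≡
                            (if does (u ≟ v) then 0 else indicator v)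
          punctured v with χ v | does (u ≟ v)
          ... | true  | true  = refl
          ... | true  | false = refl
          ... | false | true  = refl
          ... | false | false = refl

    splitCost-identity : splitCost + degSumIn ≡ size χ * (size χ ∸ 1) + degSumOut
    splitCost-identity = +-cancelʳ-≡ (∑₂ crossing) _ _ (begin
      splitCost + degSumIn + ∑₂ crossing
        ≡⟨ cong (λ s → splitCost + s + ∑₂ crossing) ∑inDeg ⟨
      ∑₂ splitPair + ∑₂ inDeg + ∑₂ crossing
        ≡⟨ cong (_+ ∑₂ crossing) (∑₂-distrib-+ splitPair inDeg) ⟨
      ∑₂ (λ u v → splitPair u v + inDeg u v) + ∑₂ crossing
        ≡⟨ ∑₂-distrib-+ _ crossing ⟨
      ∑₂ (λ u v → splitPair u v + inDeg u v + crossing u v)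
        ≡⟨ sum-cong-≗ (λ u → sum-cong-≗ (splitPair-balance u)) ⟩
      ∑₂ (λ u v → distinctIn u v + outDeg u v + crossing v u)
        ≡⟨ ∑₂-distrib-+ _ (λ u v → crossing v u) ⟩
      ∑₂ (λ u v → distinctIn u v + outDeg u v) + ∑₂ (λ u v → crossing v u)
        ≡⟨ cong₂ _+_ (∑₂-distrib-+ distinctIn outDeg) (∑-comm (λ u v → crossing v u)) ⟩
      ∑₂ distinctIn + ∑₂ outDeg + ∑₂ crossing
        ≡⟨ cong (λ s → s + ∑₂ crossing) (cong₂ _+_ ∑distinctIn ∑outDeg) ⟩
      size χ * (size χ ∸ 1) + degSumOut + ∑₂ crossing ∎)
      where open ≡-Reasoning

splitCost-induced : ∀ {p n} {H : Graph p} {G : Graph n} (ι : InducedSubgraph H G) (χ : Fin n → Bool) →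
                    splitCost H (χ ∘ proj₁ ι) ≤ splitCost G χ
splitCost-induced {p} {n} {H} {G} (f , f-inj , adj≡) χ = begin
  ∑[ u < p ] ∑[ v < p ] splitPair H (χ ∘ f) u v
    ≡⟨ sum-cong-≗ (λ u → sum-cong-≗ (splitPair-induced u)) ⟩
  ∑[ u < p ] ∑[ v < p ] splitPair G χ (f u) (f v)
    ≤⟨ ∑-mono-≤ (λ u → ∑-∘-injective-≤ (splitPair G χ (f u)) f-inj) ⟩
  ∑[ u < p ] ∑[ y < n ] splitPair G χ (f u) y
    ≤⟨ ∑-∘-injective-≤ (λ x → ∑ (splitPair G χ x)) f-inj ⟩
  ∑[ x < n ] ∑[ y < n ] splitPair G χ x y ∎
  where
  open ≤-Reasoning
  splitPair-induced : ∀ u v → splitPair H (χ ∘ f) u v ≡ splitPair G χ (f u) (f v)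
  splitPair-induced u v with χ (f u) | χ (f v)
  ... | true  | true  rewrite does-≟-injective f-inj u v | adj≡ u v = refl
  ... | true  | false = refl
  ... | false | true  = refl
  ... | false | false rewrite adj≡ u v = refl

MarkedList : Set
MarkedList = List (Bool × ℕ)

sumBy : (Bool × ℕ → ℕ) → MarkedList → ℕ
sumBy w = sum ∘ map w

sumBy-↭ : ∀ w {P Q} → P ↭ Q → sumBy w P ≡ sumBy w Q
sumBy-↭ w P↭Q = sum-↭ (map⁺ w P↭Q)

isMarked markedValue unmarkedValue : Bool × ℕ → ℕ
isMarked      (b , _) = if b then 1 else 0
markedValue   (b , x) = if b then x else 0
unmarkedValue (b , x) = if b then 0 else x

markedValue+unmarkedValue : ∀ Q → sumBy markedValue Q + sumBy unmarkedValue Q ≡ sum (map proj₂ Q)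
markedValue+unmarkedValue []            = refl
markedValue+unmarkedValue ((b , x) ∷ Q) with b
... | true  = trans (+-assoc x _ _) (cong (x +_) (markedValue+unmarkedValue Q))
... | false = trans (x∙yz≈y∙xz (sumBy markedValue Q) x _) (cong (x +_) (markedValue+unmarkedValue Q))

markFirst : ℕ → List ℕ → MarkedList
markFirst zero    []       = []
markFirst zero    (x ∷ xs) = (false , x) ∷ markFirst zero xs
markFirst (suc k) []       = []
markFirst (suc k) (x ∷ xs) = (true , x) ∷ markFirst k xs

values-markFirst : ∀ k xs → map proj₂ (markFirst k xs) ≡ xs
values-markFirst zero    []       = refl
values-markFirst zero    (x ∷ xs) = cong (x ∷_) (values-markFirst zero xs)
values-markFirst (suc k) []       = refl
values-markFirst (suc k) (x ∷ xs) = cong (x ∷_) (values-markFirst k xs)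

isMarked-markFirst : ∀ {k} xs → k ≤ length xs → sumBy isMarked (markFirst k xs) ≡ k
isMarked-markFirst {zero}  []       _         = refl
isMarked-markFirst {zero}  (x ∷ xs) _         = isMarked-markFirst xs z≤n
isMarked-markFirst {suc k} (x ∷ xs) (s≤s k≤n) = cong suc (isMarked-markFirst xs k≤n)

markedValue-markFirst : ∀ k xs → sumBy markedValue (markFirst k xs) ≡ sum (take k xs)
markedValue-markFirst zero    []       = refl
markedValue-markFirst zero    (x ∷ xs) = markedValue-markFirst zero xs
markedValue-markFirst (suc k) []       = refl
markedValue-markFirst (suc k) (x ∷ xs) = cong (x +_) (markedValue-markFirst k xs)

unmarkedValue-markFirst : ∀ k xs → sumBy unmarkedValue (markFirst k xs) ≡ sum (drop k xs)
unmarkedValue-markFirst zero    []       = refl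
unmarkedValue-markFirst zero    (x ∷ xs) = cong (x +_) (unmarkedValue-markFirst zero xs)
unmarkedValue-markFirst (suc k) []       = refl
unmarkedValue-markFirst (suc k) (x ∷ xs) = unmarkedValue-markFirst k xs

marking-of-tabulate : ∀ {n} (f : Fin n → ℕ) Q → map proj₂ Q ≡ tabulate f →
                      ∃ λ (χ : Fin n → Bool) → Q ≡ tabulate (λ i → χ i , f i)
marking-of-tabulate {zero}  f []            _  = (λ ()) , refl
marking-of-tabulate {suc n} f ((b , x) ∷ Q) eq with x≡ , Q-values ← ∷-injective eq
  with χ , Q≡ ← marking-of-tabulate (f ∘ suc) Q Q-values
  = b Vector.∷ χ , cong₂ _∷_ (cong (b ,_) x≡) Q≡

head-dominates : ∀ {x xs} → Nonincreasing (x ∷ xs) → All (_≤ x) xs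
head-dominates ni with x≥xs ∷ _ ← Linked⇒AllPairs (λ x≥y y≥z → ≤-trans y≥z x≥y) ni = x≥xs

sum-take-≤-cons : ∀ k {x} ys → All (_≤ x) ys → Nonincreasing ys → sum (take k ys) ≤ sum (take k (x ∷ ys))
sum-take-≤-cons zero    ys       _           _  = z≤n
sum-take-≤-cons (suc k) []       _           _  = z≤n
sum-take-≤-cons (suc k) (y ∷ ys) (y≤x ∷ _) ni =
  +-mono-≤ y≤x (sum-take-≤-cons k ys (head-dominates ni) (Linked.tail ni))

markedValue≤sum-take : ∀ Q → Nonincreasing (map proj₂ Q) →
                       sumBy markedValue Q ≤ sum (take (sumBy isMarked Q) (map proj₂ Q))
markedValue≤sum-take []            _  = z≤n
markedValue≤sum-take ((true  , x) ∷ Q) ni = +-monoʳ-≤ x (markedValue≤sum-take Q (Linked.tail ni))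
markedValue≤sum-take ((false , x) ∷ Q) ni = ≤-trans (markedValue≤sum-take Q (Linked.tail ni))
  (sum-take-≤-cons (sumBy isMarked Q) (map proj₂ Q) (head-dominates ni) (Linked.tail ni))

sumBy-tabulate : ∀ {n} w (g : Fin n → Bool × ℕ) → sumBy w (tabulate g) ≡ ∑ (w ∘ g)
sumBy-tabulate w g = trans (cong sum (map-tabulate g w)) (sum-tabulate (w ∘ g))

degrees≡tabulate : ∀ {n} (G : Graph n) → degrees G ≡ tabulate (deg G)
degrees≡tabulate G = map-tabulate id (deg G)

marking-transport : ∀ {n} {G : Graph n} P → map proj₂ P ↭ degrees G →
                    ∃ λ (χ : Fin n → Bool) → ∀ w → sumBy w P ≡ ∑[ u < n ] w (χ u , deg G u)
marking-transport {G = G} P P↭degs with Q , degs≡ , P↭Q ← ↭-map-inv proj₂ P↭degs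
  with χ , Q≡ ← marking-of-tabulate (deg G) Q (trans (sym degs≡) (degrees≡tabulate G))
  = χ , λ w → trans (sumBy-↭ w P↭Q) (trans (cong (sumBy w) Q≡) (sumBy-tabulate w (λ u → χ u , deg G u)))

marking-sorting : ∀ {n} {G : Graph n} {xs} → degrees G ↭ xs → (χ : Fin n → Bool) →
                  ∃ λ Q → xs ≡ map proj₂ Q × ∀ w → ∑[ u < n ] w (χ u , deg G u) ≡ sumBy w Q
marking-sorting {G = G} degs↭xs χ
  with Q , xs≡ , marking↭Q ← ↭-map-inv proj₂
         (subst (_↭ _) (trans (degrees≡tabulate G) (sym (map-tabulate (λ u → χ u , deg G u) proj₂))) degs↭xs)
  = Q , xs≡ , λ w → trans (sym (sumBy-tabulate w (λ u → χ u , deg G u))) (sumBy-↭ w marking↭Q)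

top-marking : ∀ {n d} {G : Graph n} → IsDegSeqOf d G → ∀ k → k ≤ length d →
              ∃ λ (χ : Fin n → Bool) →
                size χ ≡ k × degSumIn G χ ≡ sum (take k d) × degSumOut G χ ≡ sum (drop k d)
top-marking {d = d} {G} (_ , d↭degs) k k≤∣d∣
  with χ , transport ← marking-transport {G = G} (markFirst k d) (subst (_↭ _) (sym (values-markFirst k d)) d↭degs)
  = χ , trans (sym (transport isMarked)) (isMarked-markFirst d k≤∣d∣)
      , trans (sym (transport markedValue)) (markedValue-markFirst k d)
      , trans (sym (transport unmarkedValue)) (unmarkedValue-markFirst k d)

marked-degree-bound : ∀ {n e} {G : Graph n} → IsDegSeqOf e G → (χ : Fin n → Bool) →
                      degSumIn G χ ≤ sum (take (size χ) e) × degSumIn G χ + degSumOut G χ ≡ sum e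
marked-degree-bound {G = G} (e-noninc , e↭degs) χ
  with Q , refl , transport ← marking-sorting {G = G} (↭-sym e↭degs) χ
  = subst₂ (λ s k → s ≤ sum (take k (map proj₂ Q))) (sym (transport markedValue)) (sym (transport isMarked))
      (markedValue≤sum-take Q e-noninc)
  , trans (cong₂ _+_ (transport markedValue) (transport unmarkedValue)) (markedValue+unmarkedValue Q)

runFrom : ℕ → List ℕ → ℕ
runFrom j []       = 0
runFrom j (x ∷ xs) = if j ≤ᵇ x then suc (runFrom (suc j) xs) else 0

runFrom≤length : ∀ j xs → runFrom j xs ≤ length xs
runFrom≤length j []       = z≤n
runFrom≤length j (x ∷ xs) with j ≤ᵇ x
... | true  = s≤s (runFrom≤length (suc j) xs)
... | false = z≤n

dominated-by : ∀ {x xs b} → Nonincreasing (x ∷ xs) → x ≤ b → All (_≤ b) (x ∷ xs)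
dominated-by ni x≤b = x≤b ∷ All.map (λ y≤x → ≤-trans y≤x x≤b) (head-dominates ni)

mFrom-beyond : ∀ j xs → All (_≤ j) xs → mFrom (suc (suc j)) xs ≡ 0
mFrom-beyond j []       []              = refl
mFrom-beyond j (x ∷ xs) (x≤j ∷ xs≤j) with suc j ≤ᵇ x | ≤ᵇ-reflects-≤ (suc j) x
... | true  | ofʸ j<x = contradiction x≤j (<⇒≱ j<x)
... | false | _       = mFrom-beyond (suc j) xs (All.map m≤n⇒m≤1+n xs≤j)

mFrom⊔≡+runFrom : ∀ j xs → Nonincreasing xs → mFrom (suc j) xs ⊔ j ≡ j + runFrom j xs
mFrom⊔≡+runFrom j []       _  = sym (+-identityʳ j)
mFrom⊔≡+runFrom j (x ∷ xs) ni with j ≤ᵇ x | ≤ᵇ-reflects-≤ j x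
... | false | ofⁿ j≰x =
  trans (cong (_⊔ j) (mFrom-beyond j xs (All.tail (dominated-by ni (<⇒≤ (≰⇒> j≰x)))))) (sym (+-identityʳ j))
... | true  | ofʸ _   = begin
  (suc j ⊔ R) ⊔ j              ≡⟨ m≥n⇒m⊔n≡m (≤-trans (n≤1+n j) (m≤m⊔n (suc j) R)) ⟩
  suc j ⊔ R                    ≡⟨ ⊔-comm (suc j) R ⟩
  R ⊔ suc j                    ≡⟨ mFrom⊔≡+runFrom (suc j) xs (Linked.tail ni) ⟩
  suc j + runFrom (suc j) xs   ≡⟨ +-suc j _ ⟨
  j + suc (runFrom (suc j) xs) ∎
  where
  open ≡-Reasoning
  R = mFrom (suc (suc j)) xs

m≡runFrom : ∀ {xs} → Nonincreasing xs → m xs ≡ runFrom 0 xs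
m≡runFrom {xs} ni = trans (sym (⊔-identityʳ (m xs))) (mFrom⊔≡+runFrom 0 xs ni)

m≤length : ∀ {xs} → Nonincreasing xs → m xs ≤ length xs
m≤length {xs} ni = subst (_≤ length xs) (sym (m≡runFrom ni)) (runFrom≤length 0 xs)

drop-runFrom-bounded : ∀ j xs → Nonincreasing xs → All (_≤ j + runFrom j xs) (drop (runFrom j xs) xs)
drop-runFrom-bounded j []       _  = []
drop-runFrom-bounded j (x ∷ xs) ni with j ≤ᵇ x | ≤ᵇ-reflects-≤ j x
... | true  | _       = subst (λ b → All (_≤ b) (drop (runFrom (suc j) xs) xs)) (sym (+-suc j _))
                          (drop-runFrom-bounded (suc j) xs (Linked.tail ni))
... | false | ofⁿ j≰x = subst (λ b → All (_≤ b) (x ∷ xs)) (sym (+-identityʳ j))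
                          (dominated-by ni (<⇒≤ (≰⇒> j≰x)))

staircase : ℕ → ℕ → ℕ
staircase j zero    = 0
staircase j (suc k) = j + staircase (suc j) k

staircase-double : ∀ j k → staircase j k * 2 ≡ j * k * 2 + k * (k ∸ 1)
staircase-double j zero          = cong (λ x → x * 2 + 0) (sym (*-zeroʳ j))
staircase-double j (suc zero)    =
  trans (cong (_* 2) (trans (+-identityʳ j) (sym (*-identityʳ j)))) (sym (+-identityʳ (j * 1 * 2)))
staircase-double j (suc (suc k)) = begin
  (j + staircase (suc j) (suc k)) * 2        ≡⟨ *-distribʳ-+ 2 j _ ⟩
  j * 2 + staircase (suc j) (suc k) * 2      ≡⟨ cong (j * 2 +_) (staircase-double (suc j) (suc k)) ⟩
  j * 2 + (suc j * suc k * 2 + suc k * k)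
    ≡⟨ solve 2 (λ j k → j :* con 2 :+ ((con 1 :+ j) :* (con 1 :+ k) :* con 2 :+ (con 1 :+ k) :* k)
                     := j :* (con 2 :+ k) :* con 2 :+ (con 2 :+ k) :* (con 1 :+ k)) refl j k ⟩
  j * suc (suc k) * 2 + suc (suc k) * suc k  ∎
  where
  open ≡-Reasoning
  open +-*-Solver

staircase≤sum-take-runFrom : ∀ j xs → staircase j (runFrom j xs) ≤ sum (take (runFrom j xs) xs)
staircase≤sum-take-runFrom j []       = z≤n
staircase≤sum-take-runFrom j (x ∷ xs) with j ≤ᵇ x | ≤ᵇ-reflects-≤ j x
... | true  | ofʸ j≤x = +-mono-≤ j≤x (staircase≤sum-take-runFrom (suc j) xs)
... | false | _       = z≤n

sum-take≤staircase : ∀ j xs → All (_≤ j) xs → ∀ k → sum (take k xs) ≤ staircase j k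
sum-take≤staircase j xs       _            zero    = z≤n
sum-take≤staircase j []       _            (suc k) = z≤n
sum-take≤staircase j (x ∷ xs) (x≤j ∷ xs≤j) (suc k) =
  +-mono-≤ x≤j (sum-take≤staircase (suc j) xs (All.map m≤n⇒m≤1+n xs≤j) k)

sum-take+staircase-runFrom : ∀ j xs → Nonincreasing xs → ∀ k →
  sum (take k xs) + staircase j (runFrom j xs) ≤ sum (take (runFrom j xs) xs) + staircase j k
sum-take+staircase-runFrom j []       _  zero    = z≤n
sum-take+staircase-runFrom j []       _  (suc k) = z≤n
sum-take+staircase-runFrom j (x ∷ xs) _  zero    =
  subst (staircase j (runFrom j (x ∷ xs)) ≤_) (sym (+-identityʳ _)) (staircase≤sum-take-runFrom j (x ∷ xs))
sum-take+staircase-runFrom j (x ∷ xs) ni (suc k) with j ≤ᵇ x | ≤ᵇ-reflects-≤ j x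
... | true  | _ = begin
  x + sum (take k xs) + (j + staircase (suc j) (runFrom (suc j) xs))
    ≡⟨ interchange x _ j _ ⟩
  x + j + (sum (take k xs) + staircase (suc j) (runFrom (suc j) xs))
    ≤⟨ +-monoʳ-≤ (x + j) (sum-take+staircase-runFrom (suc j) xs (Linked.tail ni) k) ⟩
  x + j + (sum (take (runFrom (suc j) xs) xs) + staircase (suc j) k)
    ≡⟨ interchange x j _ _ ⟩
  x + sum (take (runFrom (suc j) xs) xs) + (j + staircase (suc j) k) ∎
  where open ≤-Reasoning
... | false | ofⁿ j≰x =
  subst (_≤ j + staircase (suc j) k) (sym (+-identityʳ (x + sum (take k xs))))
        (sum-take≤staircase j (x ∷ xs) (dominated-by ni (<⇒≤ (≰⇒> j≰x))) (suc k))

sum-take+sum-drop : ∀ k xs → sum (take k xs) + sum (drop k xs) ≡ sum xs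
sum-take+sum-drop k xs = trans (sym (sum-++ (take k xs) (drop k xs))) (cong sum (take++drop≡id k xs))

sum-⊓-bounded : ∀ k ys → All (_≤ k) ys → sum (map (k ⊓_) ys) ≡ sum ys
sum-⊓-bounded k []       []             = refl
sum-⊓-bounded k (y ∷ ys) (y≤k ∷ ys≤k) = cong₂ _+_ (m≥n⇒m⊓n≡n y≤k) (sum-⊓-bounded k ys ys≤k)

Δ-m-uncapped : ∀ {xs} → Nonincreasing xs → let k = m xs in
       Δ k xs ≡ ℤ.+ (k * (k ∸ 1) + sum (drop k xs)) ℤ.- ℤ.+ sum (take k xs)
Δ-m-uncapped {xs} ni rewrite m≡runFrom ni =
  cong (λ s → ℤ.+ (runFrom 0 xs * (runFrom 0 xs ∸ 1) + s) ℤ.- ℤ.+ sum (take (runFrom 0 xs) xs))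
       (sum-⊓-bounded (runFrom 0 xs) _ (drop-runFrom-bounded 0 xs ni))

+[n+c]-+c≡+n : ∀ n c → ℤ.+ (n + c) ℤ.- ℤ.+ c ≡ ℤ.+ n
+[n+c]-+c≡+n n c =
  trans (ℤ.[+m]-[+n]≡m⊖n (n + c) c) (trans (ℤ.⊖-≥ (m≤n+m c n)) (cong ℤ.+_ (m+n∸n≡m n c)))

Δ-m≡+ : ∀ {xs D} → Nonincreasing xs → let k = m xs in
        k * (k ∸ 1) + sum (drop k xs) ≡ D + sum (take k xs) → Δ k xs ≡ ℤ.+ D
Δ-m≡+ {xs} {D} ni eq = begin
  Δ (m xs) xs
    ≡⟨ Δ-m-uncapped ni ⟩
  ℤ.+ (m xs * (m xs ∸ 1) + sum (drop (m xs) xs)) ℤ.- ℤ.+ c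
    ≡⟨ cong (λ s → ℤ.+ s ℤ.- ℤ.+ c) eq ⟩
  ℤ.+ (D + c) ℤ.- ℤ.+ c
    ≡⟨ +[n+c]-+c≡+n D c ⟩
  ℤ.+ D ∎
  where
  open ≡-Reasoning
  c = sum (take (m xs) xs)

Δ-m≤+ : ∀ {xs D} → Nonincreasing xs → let k = m xs in
        k * (k ∸ 1) + sum (drop k xs) ≤ D + sum (take k xs) → Δ k xs ℤ.≤ ℤ.+ D
Δ-m≤+ {xs} {D} ni le = begin
  Δ (m xs) xs
    ≡⟨ Δ-m-uncapped ni ⟩
  ℤ.+ (m xs * (m xs ∸ 1) + sum (drop (m xs) xs)) ℤ.- ℤ.+ c
    ≤⟨ ℤ.+-monoˡ-≤ (ℤ.- ℤ.+ c) (ℤ.+≤+ le) ⟩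
  ℤ.+ (D + c) ℤ.- ℤ.+ c
    ≡⟨ +[n+c]-+c≡+n D c ⟩
  ℤ.+ D ∎
  where
  open ℤ.≤-Reasoning
  c = sum (take (m xs) xs)

Δ-m≡splitCost : ∀ {n d} {G : Graph n} → IsDegSeqOf d G →
                ∃ λ (χ : Fin n → Bool) → Δ (m d) d ≡ ℤ.+ splitCost G χ
Δ-m≡splitCost {d = d} {G} realises@(d-noninc , _)
  with χ , size≡ , in≡ , out≡ ← top-marking {G = G} realises (m d) (m≤length d-noninc)
  = χ , Δ-m≡+ d-noninc (begin
    m d * (m d ∸ 1) + sum (drop (m d) d)   ≡⟨ cong₂ (λ k F → k * (k ∸ 1) + F) size≡ out≡ ⟨
    size χ * (size χ ∸ 1) + degSumOut G χ   ≡⟨ splitCost-identity G χ ⟨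
    splitCost G χ + degSumIn G χ            ≡⟨ cong (splitCost G χ +_) in≡ ⟩
    splitCost G χ + sum (take (m d) d)      ∎)
  where open ≡-Reasoning

splittance-arithmetic : ∀ {D T F c s P Q K M} → D + T ≡ K + F → T + F ≡ c + s → T + P ≤ c + Q →
                        P * 2 ≡ M → Q * 2 ≡ K → M + s ≤ D + c
splittance-arithmetic {D} {T} {F} {c} {s} {P} {Q} {K} {M} DT≡KF TF≡cs TP≤cQ P2≡M Q2≡K =
  +-cancelʳ-≤ (T * 2) (M + s) (D + c) (begin
    M + s + T * 2      ≡⟨ cong (λ x → x + s + T * 2) P2≡M ⟨
    P * 2 + s + T * 2  ≡⟨ solve 3 (λ P s T → P :* con 2 :+ s :+ T :* con 2 := (T :+ P) :* con 2 :+ s) refl P s T ⟩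
    (T + P) * 2 + s    ≤⟨ +-monoˡ-≤ s (*-monoˡ-≤ 2 TP≤cQ) ⟩
    (c + Q) * 2 + s    ≡⟨ solve 3 (λ c Q s → (c :+ Q) :* con 2 :+ s := Q :* con 2 :+ c :+ (c :+ s)) refl c Q s ⟩
    Q * 2 + c + (c + s) ≡⟨ cong₂ (λ x y → x + c + y) Q2≡K (sym TF≡cs) ⟩
    K + c + (T + F)    ≡⟨ solve 4 (λ K c T F → K :+ c :+ (T :+ F) := K :+ F :+ c :+ T) refl K c T F ⟩
    K + F + c + T      ≡⟨ cong (λ x → x + c + T) DT≡KF ⟨
    D + T + c + T      ≡⟨ solve 3 (λ D T c → D :+ T :+ c :+ T := D :+ c :+ T :* con 2) refl D T c ⟩
    D + c + T * 2      ∎)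
  where
  open ≤-Reasoning
  open +-*-Solver

Δ-m≤splitCost : ∀ {n e} {G : Graph n} → IsDegSeqOf e G → (χ : Fin n → Bool) →
                Δ (m e) e ℤ.≤ ℤ.+ splitCost G χ
Δ-m≤splitCost {e = e} {G} realises@(e-noninc , _) χ
  with in≤top , in+out≡ ← marked-degree-bound {G = G} realises χ
  = Δ-m≤+ e-noninc (splittance-arithmetic (splitCost-identity G χ)
      (trans in+out≡ (sym (sum-take+sum-drop (m e) e)))
      (≤-trans (+-monoˡ-≤ _ in≤top) run-maximal)
      (staircase-double 0 (m e)) (staircase-double 0 k))
  where
  k = size χ
  run-maximal : sum (take k e) + staircase 0 (m e) ≤ sum (take (m e) e) + staircase 0 k
  run-maximal = subst (λ r → sum (take k e) + staircase 0 r ≤ sum (take r e) + staircase 0 k)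
                      (sym (m≡runFrom e-noninc)) (sum-take+staircase-runFrom 0 e e-noninc k)

theorem4p1 : (e d : List ℕ) → IsDegreeSequence e → IsDegreeSequence d → e ≼ d →
    Δ (m e) e ℤ.≤ Δ (m d) d
theorem4p1 e d _ _ (_ , _ , H , G , e-realised , d-realised , ι)
  with χ , Δd≡ ← Δ-m≡splitCost {G = G} d-realised = begin
  Δ (m e) e                          ≤⟨ Δ-m≤splitCost e-realised (χ ∘ proj₁ ι) ⟩
  ℤ.+ splitCost H (χ ∘ proj₁ ι)      ≤⟨ ℤ.+≤+ (splitCost-induced ι χ) ⟩
  ℤ.+ splitCost G χ                  ≡⟨ Δd≡ ⟨
  Δ (m d) d                          ∎
  where open ℤ.≤-Reasoning
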